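{- Let $D$ be a digraph without digons of order $n$. Then $D$ is $k$-mixing for every $k\geq n-1$, and $\mathcal{D}_k(D)$ has diameter at most $2n$.
   Context: All digraphs are finite, loopless and without digons. For a digraph $D$ and a positive integer $k$, a $k$-coloring of $D$ is a function $\alpha\colon V(D)\to\{1,\dots,k\}$ such that every color class $\{x:\alpha(x)=i\}$ (possibly empty) induces an acyclic subdigraph. The $k$-dicoloring graph $\mathcal{D}_k(D)$ has the $k$-colorings of $D$ as vertices, two being adjacent iff they differ on exactly one vertex. $D$ is $k$-mixing if $\mathcal{D}_k(D)$ is connected. -}

module Defs where

open import Data.Nat using (ℕ; zero; suc; _≤_)
open import Data.Fin using (Fin; zero; suc; inject₁; fromℕ)
open import Data.Bool using (Bool; T)
open import Data.Product using (Σ; ∃; _×_; _,_)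
open import Data.Empty using (⊥)
open import Relation.Nullary using (¬_)
open import Relation.Binary.PropositionalEquality using (_≡_; _≢_)
open import Function.Definitions using (Injective)

record Digraph (n : ℕ) : Set where
  field
    arc      : Fin n → Fin n → Bool
    loopless : ∀ x → ¬ T (arc x x)
    noDigon  : ∀ x y → ¬ (T (arc x y) × T (arc y x))

open Digraph public

Arc : ∀ {n} → Digraph n → Fin n → Fin n → Set
Arc D x y = T (arc D x y)

record DirectedCycle {n : ℕ} (D : Digraph n) : Set where
  field
    len      : ℕ
    vert     : Fin (suc len) → Fin n
    distinct : Injective _≡_ _≡_ vert
    step     : ∀ (j : Fin len) → Arc D (vert (inject₁ j)) (vert (suc j))
    close    : Arc D (vert (fromℕ len)) (vert zero)

InducesAcyclic : ∀ {n} → Digraph n → (Fin n → Set) → Set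
InducesAcyclic D S =
  (C : DirectedCycle D) → ¬ (∀ i → S (DirectedCycle.vert C i))

IsDicoloring : ∀ {n} → Digraph n → (k : ℕ) → (Fin n → Fin k) → Set
IsDicoloring D k α = ∀ (c : Fin k) → InducesAcyclic D (λ x → α x ≡ c)

Dicoloring : ∀ {n} → Digraph n → ℕ → Set
Dicoloring D k = Σ (Fin _ → Fin k) (IsDicoloring D k)

DiffOnExactlyOne : ∀ {n k} → (Fin n → Fin k) → (Fin n → Fin k) → Set
DiffOnExactlyOne {n} α β =
  ∃ λ (v : Fin n) → (α v ≢ β v) × (∀ u → u ≢ v → α u ≡ β u)

-- Walks of length ℓ in 𝒟_k(D) between dicolorings.  Vertices of 𝒟_k(D)
-- are colourings as functions, identified pointwise.
data Walk {n : ℕ} (D : Digraph n) (k : ℕ) :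
     Dicoloring D k → Dicoloring D k → ℕ → Set where
  here : ∀ {α β : Dicoloring D k} →
         (∀ x → Data.Product.proj₁ α x ≡ Data.Product.proj₁ β x) →
         Walk D k α β zero
  step : ∀ {α β γ : Dicoloring D k} {ℓ} →
         DiffOnExactlyOne (Data.Product.proj₁ α) (Data.Product.proj₁ β) →
         Walk D k β γ ℓ → Walk D k α γ (suc ℓ)

Mixing : ∀ {n} → Digraph n → ℕ → Set
Mixing D k = ∀ (α β : Dicoloring D k) → ∃ λ ℓ → Walk D k α β ℓ

DiameterAtMost : ∀ {n} → Digraph n → ℕ → ℕ → Set
DiameterAtMost D k d =
  ∀ (α β : Dicoloring D k) → ∃ λ ℓ → (ℓ ≤ d) × Walk D k α β ℓ

{-# OPTIONS --safe #-}

-- Call (X, C) a frame for two dicolourings α, β when they agree off X, colour X with colours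
-- of C only, use no colour of C off X, and |X| ≤ |C| + 1; at the start X is every vertex and
-- C every colour. A set of at most two vertices is acyclic (no loops, no digons), so a
-- colour class confined to X can only contain a cycle when |X| ≥ 3.
-- If |X| ≥ 4, then 2|X| < 3|C|, so some colour r occurs at most twice in α and β together.
-- With at most two recolourings overall (each kept proper by a second counting argument),
-- both colourings give some v ∈ X colour r and no other vertex colour r, and (X − v, C − r)
-- is a frame for the results: 2 + 2(|X| − 1) = 2|X| steps. If |X| ≤ 3, the vertices where α
-- and β differ are recoloured one at a time in a suitable order, in at most |X| steps.
module Submission where

open import Defs
open import Data.Empty using (⊥-elim)
open import Data.Fin using (Fin; zero; suc; _≟_)
open import Data.List using (List; []; _∷_; length; filter; allFin)
open import Data.List.Properties using (length-filter; length-tabulate; filter-all; filter-reject)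
open import Data.List.Relation.Unary.All as All using (All)
open import Data.List.Relation.Unary.AllPairs using ([]; _∷_)
open import Data.List.Relation.Unary.Any using (Any; here; there; any?)
open import Data.List.Relation.Unary.Unique.Propositional using (Unique)
open import Data.List.Relation.Unary.Unique.Propositional.Properties using (filter⁺; allFin⁺)
open import Data.List.Membership.Propositional using (_∈_; _∉_; find; lose)
open import Data.List.Membership.Propositional.Properties using (∈-filter⁺; ∈-filter⁻; ∈-allFin)
open import Data.Nat using (ℕ; zero; suc; _+_; _*_; _∸_; _≤_; _<_; z≤n; s≤s; _≤?_)
open import Data.Nat.Properties using (+-mono-≤; +-suc; +-comm; *-comm; 1+n≰n; +-monoˡ-≤; +-monoʳ-≤; <⇒≱; m≤n+m∸n; *-monoʳ-≤; *-monoˡ-≤; ∸-monoˡ-≤; ≰⇒>; m≤m+n; +-identityʳ; ≤-refl; ≤-trans; ≤-pred; suc-injective; +-commutativeSemigroup; module ≤-Reasoning)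
open import Algebra.Properties.CommutativeSemigroup +-commutativeSemigroup using (interchange)
open import Data.Nat.Tactic.RingSolver using (solve-∀)
open import Data.Product using (∃; _×_; _,_; proj₁; proj₂)
open import Data.Sum using (_⊎_; inj₁; inj₂)
open import Data.Vec.Functional using (updateAt)
open import Data.Vec.Functional.Properties using (updateAt-updates; updateAt-minimal)
open import Function using (_∘_; id; const; case_of_)
open import Relation.Binary.PropositionalEquality
open import Relation.Nullary using (¬_; yes; no)
open import Relation.Nullary.Decidable using (¬?; decidable-stable)
open import Relation.Unary using (Decidable)
open import Relation.Unary.Properties using (∁?)

length≤1⇒singleton : ∀ {A : Set} {xs : List A} → A → length xs ≤ 1 →
                     ∃ λ z → ∀ {w} → w ∈ xs → w ≡ z
length≤1⇒singleton {xs = []}        d _        = d , λ ()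
length≤1⇒singleton {xs = z ∷ []}    _ _        = z , λ { (here w≡z) → w≡z }
length≤1⇒singleton {xs = _ ∷ _ ∷ _} _ (s≤s ())

module _ {A : Set} {P : A → Set} (P? : Decidable P) where

  length-filter-∁ : ∀ xs → length (filter P? xs) + length (filter (∁? P?) xs) ≡ length xs
  length-filter-∁ []       = refl
  length-filter-∁ (x ∷ xs) with P? x
  ... | yes _ = cong suc (length-filter-∁ xs)
  ... | no  _ = trans (+-suc (length (filter P? xs)) _) (cong suc (length-filter-∁ xs))

  filter-filter-⇒ : ∀ {Q : A → Set} (Q? : Decidable Q) → (∀ {x} → Q x → P x) →
                    ∀ xs → filter Q? (filter P? xs) ≡ filter Q? xs
  filter-filter-⇒ Q? Q⇒P []       = refl
  filter-filter-⇒ Q? Q⇒P (x ∷ xs) with P? x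
  ... | no ¬px = trans (filter-filter-⇒ Q? Q⇒P xs) (sym (filter-reject Q? (¬px ∘ Q⇒P)))
  ... | yes _ with Q? x
  ...   | yes _ = cong (x ∷_) (filter-filter-⇒ Q? Q⇒P xs)
  ...   | no  _ = filter-filter-⇒ Q? Q⇒P xs

module _ {m : ℕ} where

  infixl 5 _∖_
  _∖_ : List (Fin m) → Fin m → List (Fin m)
  xs ∖ x = filter (λ y → ¬? (y ≟ x)) xs

  ∈-∖⁺ : ∀ {x y xs} → y ∈ xs → y ≢ x → y ∈ xs ∖ x
  ∈-∖⁺ = ∈-filter⁺ _

  ∈-∖⁻ : ∀ {x y xs} → y ∈ xs ∖ x → y ∈ xs × y ≢ x
  ∈-∖⁻ = ∈-filter⁻ _

  ∖-unique : ∀ {x xs} → Unique xs → Unique (xs ∖ x)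
  ∖-unique = filter⁺ _

  length-∖ : ∀ {x xs} → Unique xs → x ∈ xs → length xs ≡ suc (length (xs ∖ x))
  length-∖ {x} {y ∷ xs} (y∉xs ∷ _) _ with y ≟ x
  length-∖ {x} {y ∷ xs} (y∉xs ∷ _) _ | yes refl =
    cong (suc ∘ length) (sym (filter-all _ (All.map ≢-sym y∉xs)))
  length-∖ (_ ∷ _)   (here refl)  | no y≢x = ⊥-elim (y≢x refl)
  length-∖ (_ ∷ uxs) (there x∈xs) | no _   = cong suc (length-∖ uxs x∈xs)

module _ {A : Set} {m : ℕ} where

  fibre : (A → Fin m) → Fin m → List A → List A
  fibre f c = filter (λ x → f x ≟ c)

  pigeonhole : ∀ {t} (f g : A → Fin m) {C : List (Fin m)} → Unique C → ∀ xs ys →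
               (∀ {c} → c ∈ C → t ≤ length (fibre f c xs) + length (fibre g c ys)) →
               length C * t ≤ length xs + length ys
  pigeonhole f g []            xs ys _     = z≤n
  pigeonhole {t} f g {c ∷ C} (c∉C ∷ uC) xs ys crowded = begin
    t + length C * t
      ≤⟨ +-mono-≤ (crowded (here refl)) (pigeonhole f g uC xs′ ys′ crowded′) ⟩
    (length (fibre f c xs) + length (fibre g c ys)) + (length xs′ + length ys′)
      ≡⟨ interchange (length (fibre f c xs)) _ _ _ ⟩
    (length (fibre f c xs) + length xs′) + (length (fibre g c ys) + length ys′)
      ≡⟨ cong₂ _+_ (length-filter-∁ _ xs) (length-filter-∁ _ ys) ⟩
    length xs + length ys ∎
    where
    open ≤-Reasoning
    xs′ = filter (∁? (λ x → f x ≟ c)) xs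
    ys′ = filter (∁? (λ x → g x ≟ c)) ys
    crowded′ : ∀ {c′} → c′ ∈ C → t ≤ length (fibre f c′ xs′) + length (fibre g c′ ys′)
    crowded′ {c′} c′∈C =
      subst (t ≤_) (sym (cong₂ _+_ (cong length (filter-filter-⇒ _ _ avoids xs))
                                    (cong length (filter-filter-⇒ _ _ avoids ys))))
            (crowded (there c′∈C))
      where
      avoids : ∀ {d} → d ≡ c′ → d ≢ c
      avoids d≡c′ d≡c = All.lookup c∉C c′∈C (trans (sym d≡c) d≡c′)

three-in-pair : ∀ {A : Set} {a b c p q : A} →
                (a ≡ p ⊎ a ≡ q) → (b ≡ p ⊎ b ≡ q) → (c ≡ p ⊎ c ≡ q) → a ≡ b ⊎ a ≡ c ⊎ b ≡ c
three-in-pair (inj₁ a≡p) (inj₁ b≡p) _          = inj₁ (trans a≡p (sym b≡p))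
three-in-pair (inj₂ a≡q) (inj₂ b≡q) _          = inj₁ (trans a≡q (sym b≡q))
three-in-pair (inj₁ a≡p) (inj₂ _)   (inj₁ c≡p) = inj₂ (inj₁ (trans a≡p (sym c≡p)))
three-in-pair (inj₁ _)   (inj₂ b≡q) (inj₂ c≡q) = inj₂ (inj₂ (trans b≡q (sym c≡q)))
three-in-pair (inj₂ _)   (inj₁ b≡p) (inj₁ c≡p) = inj₂ (inj₂ (trans b≡p (sym c≡p)))
three-in-pair (inj₂ a≡q) (inj₁ _)   (inj₂ c≡q) = inj₂ (inj₁ (trans a≡q (sym c≡q)))

_[_↦_] : ∀ {n k} → (Fin n → Fin k) → Fin n → Fin k → (Fin n → Fin k)
φ [ u ↦ c ] = updateAt φ u (const c)

module _ {n k} (φ : Fin n → Fin k) {u : Fin n} {c : Fin k} where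

  [↦]-updates : (φ [ u ↦ c ]) u ≡ c
  [↦]-updates = updateAt-updates u φ

  [↦]-minimal : ∀ {w} → w ≢ u → (φ [ u ↦ c ]) w ≡ φ w
  [↦]-minimal {w} w≢u = updateAt-minimal w u φ w≢u

module _ {n} (D : Digraph n) where

  inducesAcyclic-⊆ : ∀ {S T : Fin n → Set} → (∀ u → S u → T u) →
                     InducesAcyclic D T → InducesAcyclic D S
  inducesAcyclic-⊆ S⊆T acyclic C inS = acyclic C (λ i → S⊆T _ (inS i))

  inducesAcyclic-pair : ∀ {S : Fin n → Set} p q → (∀ {w} → S w → w ≡ p ⊎ w ≡ q) →
                        InducesAcyclic D S
  inducesAcyclic-pair p q S⊆pq record { len = zero ; vert = vert ; close = close } _ =
    loopless D (vert zero) close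
  inducesAcyclic-pair p q S⊆pq
    record { len = suc zero ; vert = vert ; step = arcs ; close = close } _ =
    noDigon D (vert zero) (vert (suc zero)) (arcs zero , close)
  inducesAcyclic-pair p q S⊆pq record { len = suc (suc _) ; distinct = distinct } inS
    with three-in-pair (S⊆pq (inS zero)) (S⊆pq (inS (suc zero))) (S⊆pq (inS (suc (suc zero))))
  ... | inj₁ v₀≡v₁        with () ← distinct v₀≡v₁
  ... | inj₂ (inj₁ v₀≡v₂) with () ← distinct v₀≡v₂
  ... | inj₂ (inj₂ v₁≡v₂) with () ← distinct v₁≡v₂

module _ {n} {D : Digraph n} {k : ℕ} where

  isDicoloring-resp : ∀ {φ ψ : Fin n → Fin k} → (∀ w → φ w ≡ ψ w) →
                      IsDicoloring D k φ → IsDicoloring D k ψ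
  isDicoloring-resp φ≗ψ valid c = inducesAcyclic-⊆ D (λ w → trans (φ≗ψ w)) (valid c)

  recolour-isDicoloring : ∀ {φ u c} q → IsDicoloring D k φ →
                          (∀ {w} → w ≢ u → φ w ≡ c → w ≡ q) → IsDicoloring D k (φ [ u ↦ c ])
  recolour-isDicoloring {φ} {u} {c} q valid others d with d ≟ c
  ... | yes refl = inducesAcyclic-pair D u q class⊆uq
    where
    class⊆uq : ∀ {w} → (φ [ u ↦ c ]) w ≡ c → w ≡ u ⊎ w ≡ q
    class⊆uq {w} e with w ≟ u
    ... | yes w≡u = inj₁ w≡u
    ... | no  w≢u = inj₂ (others w≢u (trans (sym ([↦]-minimal φ w≢u)) e))
  ... | no d≢c = inducesAcyclic-⊆ D class⊆class (valid d)
    where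
    class⊆class : ∀ w → (φ [ u ↦ c ]) w ≡ d → φ w ≡ d
    class⊆class w e with w ≟ u
    ... | yes refl = ⊥-elim (d≢c (trans (sym e) ([↦]-updates φ)))
    ... | no  w≢u  = trans (sym ([↦]-minimal φ w≢u)) e

  walk-respˡ : ∀ {α α′ β : Dicoloring D k} {ℓ} → (∀ w → proj₁ α w ≡ proj₁ α′ w) →
               Walk D k α′ β ℓ → Walk D k α β ℓ
  walk-respˡ α≗α′ (here α′≗β)             = here (λ w → trans (α≗α′ w) (α′≗β w))
  walk-respˡ α≗α′ (step (v , α′v≢ , same) w) =
    step (v , (α′v≢ ∘ trans (sym (α≗α′ v))) , (λ u u≢v → trans (α≗α′ u) (same u u≢v))) w

  walk-++ : ∀ {α β γ : Dicoloring D k} {ℓ₁ ℓ₂} →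
            Walk D k α β ℓ₁ → Walk D k β γ ℓ₂ → Walk D k α γ (ℓ₁ + ℓ₂)
  walk-++ (here α≗β) w′ = walk-respˡ α≗β w′
  walk-++ (step d w) w′ = step d (walk-++ w w′)

  walk-reverse : ∀ {α β : Dicoloring D k} {ℓ} → Walk D k α β ℓ → Walk D k β α ℓ
  walk-reverse (here α≗β) = here (sym ∘ α≗β)
  walk-reverse {α} {ℓ = suc ℓ} (step (v , αv≢ , same) w) =
    subst (Walk D k _ α) (+-comm ℓ 1)
      (walk-++ (walk-reverse w)
               (step {β = α} (v , ≢-sym αv≢ , (λ u u≢v → sym (same u u≢v))) (here (λ _ → refl))))

  walk-recolour : ∀ (α : Dicoloring D k) {u c} → proj₁ α u ≢ c →
                  (valid : IsDicoloring D k (proj₁ α [ u ↦ c ])) →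
                  Walk D k α (proj₁ α [ u ↦ c ] , valid) 1
  walk-recolour α {u} {c} αu≢c valid =
    step {β = proj₁ α [ u ↦ c ] , valid}
         (u , (αu≢c ∘ (λ e → trans e ([↦]-updates (proj₁ α)))) ,
          (λ w w≢u → sym ([↦]-minimal (proj₁ α) w≢u)))
         (here (λ _ → refl))

record Confined {n k} (X : List (Fin n)) (C : List (Fin k)) (φ : Fin n → Fin k) : Set where
  field
    inside  : ∀ {u} → u ∈ X → φ u ∈ C
    outside : ∀ {u} → φ u ∈ C → u ∈ X

open Confined

Isolated : ∀ {n k} → Fin n → Fin k → (Fin n → Fin k) → Set
Isolated v r φ = φ v ≡ r × (∀ {w} → w ≢ v → φ w ≢ r)

module _ {n k} {X : List (Fin n)} {C : List (Fin k)} where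

  confined-recolour : ∀ {φ u c} → Confined X C φ → u ∈ X → c ∈ C → Confined X C (φ [ u ↦ c ])
  confined-recolour {φ} {u} {c} conf u∈X c∈C = record { inside = inside′ ; outside = outside′ }
    where
    inside′ : ∀ {w} → w ∈ X → (φ [ u ↦ c ]) w ∈ C
    inside′ {w} w∈X with w ≟ u
    ... | yes refl = subst (_∈ C) (sym ([↦]-updates φ)) c∈C
    ... | no  w≢u  = subst (_∈ C) (sym ([↦]-minimal φ w≢u)) (inside conf w∈X)
    outside′ : ∀ {w} → (φ [ u ↦ c ]) w ∈ C → w ∈ X
    outside′ {w} φ′w∈C with w ≟ u
    ... | yes refl = u∈X
    ... | no  w≢u  = outside conf (subst (_∈ C) ([↦]-minimal φ w≢u) φ′w∈C)

  confined-restrict : ∀ {φ v r} → Confined X C φ → Isolated v r φ → Confined (X ∖ v) (C ∖ r) φ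
  confined-restrict {φ} {v} {r} conf (φv≡r , alone) = record
    { inside  = λ w∈X∖v → let w∈X , w≢v = ∈-∖⁻ w∈X∖v in ∈-∖⁺ (inside conf w∈X) (alone w≢v)
    ; outside = λ φw∈C∖r → let φw∈C , φw≢r = ∈-∖⁻ φw∈C∖r in
                 ∈-∖⁺ (outside conf φw∈C) (λ w≡v → φw≢r (trans (cong φ w≡v) φv≡r))
    }

Others : ∀ {n k} → (Fin n → Fin k) → Fin n → Fin k → List (Fin n) → Set
Others φ v r O = (∀ {w} → w ∈ O → w ≢ v × φ w ≡ r) × (∀ {w} → w ≢ v → φ w ≡ r → w ∈ O)

record Reach {n} {D : Digraph n} {k} (X : List (Fin n)) (C : List (Fin k))
             (α : Dicoloring D k) (bound : ℕ) (P : (Fin n → Fin k) → Set) : Set where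
  field
    target   : Dicoloring D k
    steps    : ℕ
    steps≤   : steps ≤ bound
    walk     : Walk D k α target steps
    confined : Confined X C (proj₁ target)
    fixed    : ∀ {w} → w ∉ X → proj₁ target w ≡ proj₁ α w
    property : P (proj₁ target)

module _ {n} {D : Digraph n} {k} {X : List (Fin n)} {C : List (Fin k)} where

  stay : ∀ {α : Dicoloring D k} {b P} → Confined X C (proj₁ α) → P (proj₁ α) → Reach X C α b P
  stay {α} conf p = record
    { target = α ; steps = 0 ; steps≤ = z≤n ; walk = here (λ _ → refl)
    ; confined = conf ; fixed = λ _ → refl ; property = p }

  recolour : ∀ (α : Dicoloring D k) {u c P} → Confined X C (proj₁ α) → u ∈ X → c ∈ C →
             proj₁ α u ≢ c → (valid : IsDicoloring D k (proj₁ α [ u ↦ c ])) →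
             P (proj₁ α [ u ↦ c ]) → Reach X C α 1 P
  recolour α conf u∈X c∈C αu≢c valid p = record
    { steps = 1 ; steps≤ = ≤-refl ; walk = walk-recolour α αu≢c valid
    ; confined = confined-recolour conf u∈X c∈C
    ; fixed = λ w∉X → [↦]-minimal (proj₁ α) (λ { refl → w∉X u∈X })
    ; property = p }

  infixl 1 _then_
  _then_ : ∀ {α : Dicoloring D k} {b₁ b₂ P Q} → Reach X C α b₁ P →
           (∀ {ψ : Dicoloring D k} → Confined X C (proj₁ ψ) → P (proj₁ ψ) → Reach X C ψ b₂ Q) →
           Reach X C α (b₁ + b₂) Q
  first then next = record
    { steps = R.steps + S.steps ; steps≤ = +-mono-≤ R.steps≤ S.steps≤
    ; walk = walk-++ R.walk S.walk ; confined = S.confined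
    ; fixed = λ w∉X → trans (S.fixed w∉X) (R.fixed w∉X) ; property = S.property }
    where
    module R = Reach first
    module S = Reach (next R.confined R.property)

  place : ∀ (φ : Dicoloring D k) → Confined X C (proj₁ φ) → ∀ {v r} → v ∈ X → r ∈ C →
          (∀ {w} → w ≢ v → proj₁ φ w ≢ r) → Reach X C φ 1 (Isolated v r)
  place φ conf {v} {r} v∈X r∈C alone with proj₁ φ v ≟ r
  ... | yes φv≡r = stay conf (φv≡r , alone)
  ... | no  φv≢r = recolour φ conf v∈X r∈C φv≢r
    (recolour-isDicoloring v (proj₂ φ) (λ w≢v φw≡r → ⊥-elim (alone w≢v φw≡r)))
    ([↦]-updates (proj₁ φ) , λ w≢v φ′w≡r → alone w≢v (trans (sym ([↦]-minimal (proj₁ φ) w≢v)) φ′w≡r))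

module Isolation {n} {D : Digraph n} {k} {X : List (Fin n)} {C : List (Fin k)}
                 (uX : Unique X) (uC : Unique C) (sparse : length X ≤ 2 * (length C ∸ 1)) where

  -- Pigeonhole: the other vertices cannot occupy each of the other colours twice.
  vacate : ∀ (φ : Dicoloring D k) → Confined X C (proj₁ φ) → ∀ {u} → u ∈ X →
           ∃ λ c → c ∈ C × c ≢ proj₁ φ u × IsDicoloring D k (proj₁ φ [ u ↦ c ])
  vacate (φ , valid) conf {u} u∈X with any? (λ c → length (fibre φ c (X ∖ u)) ≤? 1) (C ∖ φ u)
  ... | yes rare =
    let c , c∈C∖φu , few = find rare
        c∈C , c≢φu = ∈-∖⁻ c∈C∖φu
        q , fibre⊆q = length≤1⇒singleton u few
        in-fibre : ∀ {w} → w ≢ u → φ w ≡ c → w ∈ fibre φ c (X ∖ u)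
        in-fibre w≢u φw≡c = ∈-filter⁺ _ (∈-∖⁺ (outside conf (subst (_∈ C) (sym φw≡c) c∈C)) w≢u) φw≡c
    in c , c∈C , c≢φu , recolour-isDicoloring q valid (λ w≢u φw≡c → fibre⊆q (in-fibre w≢u φw≡c))
  ... | no none = ⊥-elim (1+n≰n (begin
    suc (length (X ∖ u))          ≡⟨ length-∖ uX u∈X ⟨
    length X                      ≤⟨ sparse ⟩
    2 * (length C ∸ 1)            ≡⟨ cong (λ l → 2 * (l ∸ 1)) (length-∖ uC (inside conf u∈X)) ⟩
    2 * length (C ∖ φ u)          ≡⟨ *-comm 2 (length (C ∖ φ u)) ⟩
    length (C ∖ φ u) * 2          ≤⟨ pigeonhole φ φ (∖-unique uC) (X ∖ u) [] crowded ⟩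
    length (X ∖ u) + 0            ≡⟨ +-identityʳ _ ⟩
    length (X ∖ u)                ∎))
    where
    open ≤-Reasoning
    crowded : ∀ {c} → c ∈ C ∖ φ u → 2 ≤ length (fibre φ c (X ∖ u)) + length (fibre φ c [])
    crowded c∈ = ≤-trans (≰⇒> (none ∘ lose c∈)) (m≤m+n _ _)

  clear : ∀ (φ : Dicoloring D k) → Confined X C (proj₁ φ) → ∀ {v r} → r ∈ C →
          ∀ O → length O ≤ 1 → Others (proj₁ φ) v r O →
          Reach X C φ (length O) (λ ψ → ψ v ≡ proj₁ φ v × (∀ {w} → w ≢ v → ψ w ≢ r))
  clear φ conf r∈C [] _ (_ , complete) =
    stay conf (refl , λ w≢v φw≡r → case complete w≢v φw≡r of λ ())
  clear φ conf {v} {r} r∈C (u ∷ []) _ (sound , complete)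
    with sound (here refl)
  ... | u≢v , φu≡r
    with u∈X ← outside conf (subst (_∈ C) (sym φu≡r) r∈C)
    with vacate φ conf u∈X
  ... | c , c∈C , c≢φu , valid =
    recolour φ conf u∈X c∈C (≢-sym c≢φu) valid ([↦]-minimal (proj₁ φ) (≢-sym u≢v) , alone)
    where
    alone : ∀ {w} → w ≢ v → (proj₁ φ [ u ↦ c ]) w ≢ r
    alone {w} w≢v φ′w≡r with w ≟ u
    ... | yes refl = c≢φu (trans (sym ([↦]-updates (proj₁ φ))) (trans φ′w≡r (sym φu≡r)))
    ... | no  w≢u  with complete w≢v (trans (sym ([↦]-minimal (proj₁ φ) w≢u)) φ′w≡r)
    ...   | here w≡u = w≢u w≡u
  clear _ _ _ (_ ∷ _ ∷ _) (s≤s ())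

  isolate : ∀ (φ : Dicoloring D k) → Confined X C (proj₁ φ) → ∀ {v r} → v ∈ X → r ∈ C →
            ∀ O → length O ≤ 1 → Others (proj₁ φ) v r O → Reach X C φ (length O + 1) (Isolated v r)
  isolate φ conf v∈X r∈C O few others =
    clear φ conf r∈C O few others then λ {ψ} conf′ (_ , alone) → place ψ conf′ v∈X r∈C alone

  isolate-at : ∀ (φ : Dicoloring D k) → Confined X C (proj₁ φ) → ∀ {v r} → proj₁ φ v ≡ r → r ∈ C →
               ∀ O → length O ≤ 1 → Others (proj₁ φ) v r O → Reach X C φ (length O) (Isolated v r)
  isolate-at φ conf {v} {r} φv≡r r∈C O few others =
    subst (λ b → Reach X C φ b (Isolated v r)) (+-identityʳ (length O))
      (clear φ conf r∈C O few others then λ conf′ (ψv≡φv , alone) → stay conf′ (trans ψv≡φv φv≡r , alone))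

agree-unless-listed : ∀ {n k} {φ ψ : Fin n → Fin k} {w} Δ → (φ w ≢ ψ w → w ∈ Δ) →
                      ¬ Any (λ v → φ v ≢ ψ v) Δ → φ w ≡ ψ w
agree-unless-listed {φ = φ} {ψ} {w} Δ listed none =
  decidable-stable (φ w ≟ ψ w) (λ φw≢ψw → none (lose (listed φw≢ψw) φw≢ψw))

module SmallFrame {n} {D : Digraph n} {k} {X : List (Fin n)} {C : List (Fin k)}
                  (uX : Unique X) (|X|≤3 : length X ≤ 3) where

  open import Data.List.Membership.DecPropositional {A = Fin n} _≟_ using (_∈?_)

  third-vertex : ∀ {x y} → x ∈ X → y ∈ X → x ≢ y →
                 ∃ λ z → ∀ {w} → w ∈ X → w ≡ x ⊎ w ≡ y ⊎ w ≡ z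
  third-vertex {x} {y} x∈X y∈X x≢y = z , cover
    where
    lengths : length X ≡ suc (suc (length (X ∖ x ∖ y)))
    lengths = trans (length-∖ uX x∈X) (cong suc (length-∖ (∖-unique uX) (∈-∖⁺ y∈X (≢-sym x≢y))))
    rest = length≤1⇒singleton x (≤-pred (≤-pred (subst (_≤ 3) lengths |X|≤3)))
    z = proj₁ rest
    cover : ∀ {w} → w ∈ X → w ≡ x ⊎ w ≡ y ⊎ w ≡ z
    cover {w} w∈X with w ≟ x | w ≟ y
    ... | yes w≡x | _       = inj₁ w≡x
    ... | no _    | yes w≡y = inj₂ (inj₁ w≡y)
    ... | no w≢x  | no w≢y  = inj₂ (inj₂ (proj₂ rest (∈-∖⁺ (∈-∖⁺ w∈X w≢x) w≢y)))

  module _ {α β : Fin n → Fin k} (confα : Confined X C α) (confβ : Confined X C β) where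

    coloured-like-∈ : ∀ {u w} → u ∈ X → α w ≡ β u → w ∈ X
    coloured-like-∈ u∈X αw≡βu = outside confα (subst (_∈ C) (sym αw≡βu) (inside confβ u∈X))

    -- With X ⊆ {x, y, z}, recolouring x fails only if α y = α z = β x, and then recolouring y
    -- fails only if α x = α z = β y, which would force α x = β x.
    progress : IsDicoloring D k α → ∀ {x y} → x ∈ X → y ∈ X → x ≢ y → α x ≢ β x →
               IsDicoloring D k (α [ x ↦ β x ]) ⊎ IsDicoloring D k (α [ y ↦ β y ])
    progress valid {x} {y} x∈X y∈X x≢y αx≢βx with third-vertex x∈X y∈X x≢y
    ... | z , cover with α y ≟ β x | α z ≟ β x
    ... | no αy≢βx | _ = inj₁ (recolour-isDicoloring z valid λ w≢x αw≡βx →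
      case cover (coloured-like-∈ x∈X αw≡βx) of λ
        { (inj₁ w≡x)         → ⊥-elim (w≢x w≡x)
        ; (inj₂ (inj₁ refl)) → ⊥-elim (αy≢βx αw≡βx)
        ; (inj₂ (inj₂ w≡z))  → w≡z })
    ... | yes _ | no αz≢βx = inj₁ (recolour-isDicoloring y valid λ w≢x αw≡βx →
      case cover (coloured-like-∈ x∈X αw≡βx) of λ
        { (inj₁ w≡x)         → ⊥-elim (w≢x w≡x)
        ; (inj₂ (inj₁ w≡y))  → w≡y
        ; (inj₂ (inj₂ refl)) → ⊥-elim (αz≢βx αw≡βx) })
    ... | yes αy≡βx | yes αz≡βx with α x ≟ β y | α z ≟ β y
    ...   | no αx≢βy | _ = inj₂ (recolour-isDicoloring z valid λ w≢y αw≡βy →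
      case cover (coloured-like-∈ y∈X αw≡βy) of λ
        { (inj₁ refl)        → ⊥-elim (αx≢βy αw≡βy)
        ; (inj₂ (inj₁ w≡y))  → ⊥-elim (w≢y w≡y)
        ; (inj₂ (inj₂ w≡z))  → w≡z })
    ...   | yes _ | no αz≢βy = inj₂ (recolour-isDicoloring x valid λ w≢y αw≡βy →
      case cover (coloured-like-∈ y∈X αw≡βy) of λ
        { (inj₁ w≡x)         → w≡x
        ; (inj₂ (inj₁ w≡y))  → ⊥-elim (w≢y w≡y)
        ; (inj₂ (inj₂ refl)) → ⊥-elim (αz≢βy αw≡βy) })
    ...   | yes αx≡βy | yes αz≡βy = ⊥-elim (αx≢βx (trans αx≡βy (trans (sym αz≡βy) αz≡βx)))

  module _ {β : Dicoloring D k} (confβ : Confined X C (proj₁ β)) where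

    equal-or-recolourable : ∀ (α : Dicoloring D k) → Confined X C (proj₁ α) →
              ∀ Δ → (∀ {w} → w ∈ Δ → w ∈ X) → (∀ {w} → proj₁ α w ≢ proj₁ β w → w ∈ Δ) →
              (∀ w → proj₁ α w ≡ proj₁ β w) ⊎
              ∃ λ u → u ∈ Δ × proj₁ α u ≢ proj₁ β u × IsDicoloring D k (proj₁ α [ u ↦ proj₁ β u ])
    equal-or-recolourable (α , valid) confα Δ Δ⊆X diff⊆Δ with any? (λ w → ¬? (α w ≟ proj₁ β w)) Δ
    ... | no none = inj₁ (λ _ → agree-unless-listed Δ diff⊆Δ none)
    ... | yes some with find some
    ... | x , x∈Δ , αx≢βx with any? (λ w → ¬? (α w ≟ proj₁ β w)) (Δ ∖ x)
    ...   | no none = inj₂ (x , x∈Δ , αx≢βx , isDicoloring-resp (sym ∘ recoloured≗β) (proj₂ β))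
      where
      recoloured≗β : ∀ w → (α [ x ↦ proj₁ β x ]) w ≡ proj₁ β w
      recoloured≗β w with w ≟ x
      ... | yes refl = [↦]-updates α
      ... | no  w≢x  = trans ([↦]-minimal α w≢x)
                             (agree-unless-listed (Δ ∖ x) (λ αw≢βw → ∈-∖⁺ (diff⊆Δ αw≢βw) w≢x) none)
    ...   | yes some′ with find some′
    ...     | y , y∈Δ∖x , αy≢βy with ∈-∖⁻ y∈Δ∖x
    ...       | y∈Δ , y≢x with progress confα confβ valid (Δ⊆X x∈Δ) (Δ⊆X y∈Δ) (≢-sym y≢x) αx≢βx
    ...         | inj₁ valid′ = inj₂ (x , x∈Δ , αx≢βx , valid′)
    ...         | inj₂ valid′ = inj₂ (y , y∈Δ , αy≢βy , valid′)

    converge : ∀ d (α : Dicoloring D k) → Confined X C (proj₁ α) →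
               ∀ Δ → length Δ ≡ d → Unique Δ → (∀ {w} → w ∈ Δ → w ∈ X) →
               (∀ {w} → proj₁ α w ≢ proj₁ β w → w ∈ Δ) → ∃ λ ℓ → ℓ ≤ d × Walk D k α β ℓ
    converge zero α _ [] refl _ _ diff⊆[] =
      0 , z≤n , here (λ w → agree-unless-listed {φ = proj₁ α} {proj₁ β} {w} [] diff⊆[] λ ())
    converge (suc d) α confα Δ |Δ| uΔ Δ⊆X diff⊆Δ with equal-or-recolourable α confα Δ Δ⊆X diff⊆Δ
    ... | inj₁ α≗β = 0 , z≤n , here α≗β
    ... | inj₂ (u , u∈Δ , αu≢βu , valid) =
      let ℓ , ℓ≤d , walk =
            converge d α′ confα′ (Δ ∖ u) |Δ∖u| (∖-unique uΔ) (Δ⊆X ∘ proj₁ ∘ ∈-∖⁻) diff⊆Δ∖u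
      in suc ℓ , s≤s ℓ≤d , walk-++ (walk-recolour α αu≢βu valid) walk
      where
      α′ : Dicoloring D k
      α′ = proj₁ α [ u ↦ proj₁ β u ] , valid
      confα′ : Confined X C (proj₁ α′)
      confα′ = confined-recolour confα (Δ⊆X u∈Δ) (inside confβ (Δ⊆X u∈Δ))
      |Δ∖u| : length (Δ ∖ u) ≡ d
      |Δ∖u| = suc-injective (trans (sym (length-∖ uΔ u∈Δ)) |Δ|)
      diff⊆Δ∖u : ∀ {w} → proj₁ α′ w ≢ proj₁ β w → w ∈ Δ ∖ u
      diff⊆Δ∖u {w} α′w≢βw with w ≟ u
      ... | yes refl = ⊥-elim (α′w≢βw ([↦]-updates (proj₁ α)))
      ... | no  w≢u  = ∈-∖⁺ (diff⊆Δ (α′w≢βw ∘ trans ([↦]-minimal (proj₁ α) w≢u))) w≢u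

  small-walk : ∀ (α β : Dicoloring D k) → Confined X C (proj₁ α) → Confined X C (proj₁ β) →
               (∀ {w} → w ∉ X → proj₁ α w ≡ proj₁ β w) → ∃ λ ℓ → ℓ ≤ length X × Walk D k α β ℓ
  small-walk α β confα confβ agree = converge confβ (length X) α confα X refl uX (λ w∈X → w∈X) diff⊆X
    where
    diff⊆X : ∀ {w} → proj₁ α w ≢ proj₁ β w → w ∈ X
    diff⊆X {w} αw≢βw = decidable-stable (w ∈? X) (αw≢βw ∘ agree)

ShortWalks : ∀ {n} → Digraph n → ℕ → ℕ → Set
ShortWalks D k m = ∀ {X C} → length X ≡ m → Unique X → Unique C → m ≤ suc (length C) →
  (α β : Dicoloring D k) → Confined X C (proj₁ α) → Confined X C (proj₁ β) →
  (∀ {w} → w ∉ X → proj₁ α w ≡ proj₁ β w) → ∃ λ ℓ → ℓ ≤ 2 * m × Walk D k α β ℓ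

shortWalks-small : ∀ {n} {D : Digraph n} {k m} → m ≤ 3 → ShortWalks D k m
shortWalks-small {m = m} m≤3 |X| uX _ _ α β confα confβ agree
  with ℓ , ℓ≤|X| , walk ← SmallFrame.small-walk uX (subst (_≤ 3) (sym |X|) m≤3) α β confα confβ agree
  = ℓ , ≤-trans (subst (ℓ ≤_) |X| ℓ≤|X|) (m≤m+n m (m + 0)) , walk

nonempty : ∀ {A : Set} {xs : List A} {l} → length xs ≡ suc l → ∃ (_∈ xs)
nonempty {xs = x ∷ _} _ = x , here refl

budget-at : ∀ {a b b′} → suc a + b ≤ 2 → b′ ≤ b → a ≤ 1 × b′ ≤ 1 × a + (b′ + 1) ≤ 2
budget-at {zero}          (s≤s b≤1)       b′≤b = z≤n , ≤-trans b′≤b b≤1 , +-monoˡ-≤ 1 (≤-trans b′≤b b≤1)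
budget-at {suc zero} {zero} _             z≤n  = s≤s z≤n , z≤n , ≤-refl
budget-at {suc zero} {suc _} (s≤s (s≤s ())) _
budget-at {suc (suc _)}   (s≤s (s≤s ()))  _

budget-total : ∀ {sα sβ bα bβ ℓ m} → sα ≤ bα → ℓ ≤ 2 * (3 + m) → sβ ≤ bβ → bα + bβ ≤ 2 →
               sα + (ℓ + sβ) ≤ 2 * (4 + m)
budget-total {sα} {sβ} {bα} {bβ} {ℓ} {m} sα≤ ℓ≤ sβ≤ budget = begin
  sα + (ℓ + sβ)            ≤⟨ +-mono-≤ sα≤ (+-mono-≤ ℓ≤ sβ≤) ⟩
  bα + (2 * (3 + m) + bβ)  ≡⟨ x+[y+z]≡y+[x+z] bα (2 * (3 + m)) bβ ⟩
  2 * (3 + m) + (bα + bβ)  ≤⟨ +-monoʳ-≤ (2 * (3 + m)) budget ⟩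
  2 * (3 + m) + 2          ≡⟨ expand m ⟩
  2 * (4 + m)              ∎
  where
  open ≤-Reasoning
  x+[y+z]≡y+[x+z] : ∀ x y z → x + (y + z) ≡ y + (x + z)
  x+[y+z]≡y+[x+z] = solve-∀
  expand : ∀ m → 2 * (3 + m) + 2 ≡ 2 * (4 + m)
  expand = solve-∀

module LargeFrame {n} {D : Digraph n} {k} {m} (shorter : ShortWalks D k (3 + m))
                  {X : List (Fin n)} {C : List (Fin k)} (|X| : length X ≡ 4 + m)
                  (uX : Unique X) (uC : Unique C) (|X|≤ : 4 + m ≤ suc (length C)) where

  sparse : length X ≤ 2 * (length C ∸ 1)
  sparse = begin
    length X            ≡⟨ |X| ⟩
    4 + m               ≤⟨ m≤m+n (4 + m) m ⟩
    (4 + m) + m         ≡⟨ expand m ⟨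
    2 * (2 + m)         ≤⟨ *-monoʳ-≤ 2 (∸-monoˡ-≤ 1 (≤-pred |X|≤)) ⟩
    2 * (length C ∸ 1)  ∎
    where
    open ≤-Reasoning
    expand : ∀ m → 2 * (2 + m) ≡ (4 + m) + m
    expand = solve-∀

  open Isolation {D = D} uX uC sparse

  crowded-free : length X + length X < length C * 3
  crowded-free = begin-strict
    length X + length X        ≡⟨ cong₂ _+_ |X| |X| ⟩
    (4 + m) + (4 + m)          <⟨ m≤m+n _ m ⟩
    suc ((4 + m) + (4 + m)) + m ≡⟨ expand m ⟨
    (3 + m) * 3                ≤⟨ *-monoˡ-≤ 3 (≤-pred |X|≤) ⟩
    length C * 3               ∎
    where
    open ≤-Reasoning
    expand : ∀ m → (3 + m) * 3 ≡ suc ((4 + m) + (4 + m)) + m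
    expand = solve-∀

  choose-colour : ∀ (α β : Fin n → Fin k) →
                  ∃ λ r → r ∈ C × length (fibre α r X) + length (fibre β r X) ≤ 2
  choose-colour α β with any? (λ c → length (fibre α c X) + length (fibre β c X) ≤? 2) C
  ... | yes rare = find rare
  ... | no  none = ⊥-elim (<⇒≱ crowded-free (pigeonhole α β uC X X (λ c∈C → ≰⇒> (none ∘ lose c∈C))))

  others-fibre : ∀ {φ v r} → Confined X C φ → r ∈ C → Others φ v r (fibre φ r X ∖ v)
  others-fibre {φ} {v} {r} conf r∈C = sound , complete
    where
    sound : ∀ {w} → w ∈ fibre φ r X ∖ v → w ≢ v × φ w ≡ r
    sound w∈ = let w∈fibre , w≢v = ∈-∖⁻ {xs = fibre φ r X} w∈ in
      w≢v , proj₂ (∈-filter⁻ (λ x → φ x ≟ r) {xs = X} w∈fibre)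
    complete : ∀ {w} → w ≢ v → φ w ≡ r → w ∈ fibre φ r X ∖ v
    complete w≢v φw≡r = ∈-∖⁺ (∈-filter⁺ _ (outside conf (subst (_∈ C) (sym φw≡r) r∈C)) φw≡r) w≢v

  absent : ∀ {φ r} → Confined X C φ → r ∈ C → ¬ Any (λ w → φ w ≡ r) X → ∀ {w} → φ w ≢ r
  absent conf r∈C none φw≡r = none (lose (outside conf (subst (_∈ C) (sym φw≡r) r∈C)) φw≡r)

  finish : ∀ {α β : Dicoloring D k} {v r bα bβ} → v ∈ X → r ∈ C →
           (∀ {w} → w ∉ X → proj₁ α w ≡ proj₁ β w) →
           Reach X C α bα (Isolated v r) → Reach X C β bβ (Isolated v r) → bα + bβ ≤ 2 →
           ∃ λ ℓ → ℓ ≤ 2 * (4 + m) × Walk D k α β ℓ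
  finish {α} {β} {v} {r} v∈X r∈C agree Rα Rβ budget =
    A.steps + (ℓ + B.steps) , budget-total A.steps≤ ℓ≤ B.steps≤ budget , walk-++ A.walk (walk-++ walk (walk-reverse B.walk))
    where
    module A = Reach Rα
    module B = Reach Rβ
    |X∖v| : length (X ∖ v) ≡ 3 + m
    |X∖v| = suc-injective (trans (sym (length-∖ uX v∈X)) |X|)
    size : 3 + m ≤ suc (length (C ∖ r))
    size = ≤-pred (subst (λ l → 4 + m ≤ suc l) (length-∖ uC r∈C) |X|≤)
    agree′ : ∀ {w} → w ∉ X ∖ v → proj₁ A.target w ≡ proj₁ B.target w
    agree′ {w} w∉X∖v with w ≟ v
    ... | yes refl = trans (proj₁ A.property) (sym (proj₁ B.property))
    ... | no  w≢v  = trans (A.fixed w∉X) (trans (agree w∉X) (sym (B.fixed w∉X)))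
      where
      w∉X : w ∉ X
      w∉X w∈X = w∉X∖v (∈-∖⁺ w∈X w≢v)
    inner : ∃ λ ℓ → ℓ ≤ 2 * (3 + m) × Walk D k A.target B.target ℓ
    inner = shorter |X∖v| (∖-unique uX) (∖-unique uC) size A.target B.target
                    (confined-restrict A.confined A.property)
                    (confined-restrict B.confined B.property) agree′
    ℓ = proj₁ inner
    ℓ≤ = proj₁ (proj₂ inner)
    walk = proj₂ (proj₂ inner)

  module _ (α β : Dicoloring D k) (confα : Confined X C (proj₁ α)) (confβ : Confined X C (proj₁ β))
           (agree : ∀ {w} → w ∉ X → proj₁ α w ≡ proj₁ β w) where

    -- With a, b the numbers of r-vertices of α and β in X, isolating v takes α at most a − 1
    -- moves and β at most b + 1, so at most a + b ≤ 2 in total.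
    via-witness : ∀ {v r} → v ∈ X → proj₁ α v ≡ r → r ∈ C →
                  length (fibre (proj₁ α) r X) + length (fibre (proj₁ β) r X) ≤ 2 →
                  ∃ λ ℓ → ℓ ≤ 2 * (4 + m) × Walk D k α β ℓ
    via-witness {v} {r} v∈X αv≡r r∈C budget =
      finish v∈X r∈C agree
        (isolate-at α confα αv≡r r∈C Oα fewα (others-fibre confα r∈C))
        (isolate β confβ v∈X r∈C Oβ fewβ (others-fibre confβ r∈C))
        cost
      where
      Oα Oβ : List (Fin n)
      Oα = fibre (proj₁ α) r X ∖ v
      Oβ = fibre (proj₁ β) r X ∖ v
      |fibreα| : length (fibre (proj₁ α) r X) ≡ suc (length Oα)
      |fibreα| = length-∖ (filter⁺ _ uX) (∈-filter⁺ _ v∈X αv≡r)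
      counts = budget-at (subst (λ a → a + _ ≤ 2) |fibreα| budget)
                         (length-filter (λ w → ¬? (w ≟ v)) (fibre (proj₁ β) r X))
      fewα = proj₁ counts
      fewβ = proj₁ (proj₂ counts)
      cost = proj₂ (proj₂ counts)

    via-fresh : ∀ {r} → r ∈ C → (∀ {w} → proj₁ α w ≢ r) → (∀ {w} → proj₁ β w ≢ r) →
                ∃ λ ℓ → ℓ ≤ 2 * (4 + m) × Walk D k α β ℓ
    via-fresh r∈C unusedα unusedβ =
      finish v∈X r∈C agree
        (isolate α confα v∈X r∈C [] z≤n ((λ ()) , λ _ αw≡r → ⊥-elim (unusedα αw≡r)))
        (isolate β confβ v∈X r∈C [] z≤n ((λ ()) , λ _ βw≡r → ⊥-elim (unusedβ βw≡r)))
        ≤-refl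
      where
      v∈X = proj₂ (nonempty |X|)

  large-walk : ∀ (α β : Dicoloring D k) → Confined X C (proj₁ α) → Confined X C (proj₁ β) →
               (∀ {w} → w ∉ X → proj₁ α w ≡ proj₁ β w) → ∃ λ ℓ → ℓ ≤ 2 * (4 + m) × Walk D k α β ℓ
  large-walk α β confα confβ agree with choose-colour (proj₁ α) (proj₁ β)
  ... | r , r∈C , budget with any? (λ w → proj₁ α w ≟ r) X | any? (λ w → proj₁ β w ≟ r) X
  ... | yes usedα | _ =
    let v , v∈X , αv≡r = find usedα
    in via-witness α β confα confβ agree v∈X αv≡r r∈C budget
  ... | no _ | yes usedβ =
    let v , v∈X , βv≡r = find usedβ
        ℓ , ℓ≤ , walk = via-witness β α confβ confα (sym ∘ agree) v∈X βv≡r r∈C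
                          (subst (_≤ 2) (+-comm (length (fibre (proj₁ α) r X)) _) budget)
    in ℓ , ℓ≤ , walk-reverse walk
  ... | no unusedα | no unusedβ =
    via-fresh α β confα confβ agree r∈C (absent confα r∈C unusedα) (absent confβ r∈C unusedβ)

shortWalks-step : ∀ {n} {D : Digraph n} {k m} → ShortWalks D k (3 + m) → ShortWalks D k (4 + m)
shortWalks-step shorter |X| uX uC |X|≤ = LargeFrame.large-walk shorter |X| uX uC |X|≤

shortWalks : ∀ {n} {D : Digraph n} {k} m → ShortWalks D k m
shortWalks 0                             = shortWalks-small z≤n
shortWalks 1                             = shortWalks-small (s≤s z≤n)
shortWalks 2                             = shortWalks-small (s≤s (s≤s z≤n))
shortWalks 3                             = shortWalks-small ≤-refl
shortWalks (suc (suc (suc (suc m))))     = shortWalks-step (shortWalks (suc (suc (suc m))))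

all-confined : ∀ {n k} (φ : Fin n → Fin k) → Confined (allFin n) (allFin k) φ
all-confined φ = record { inside = λ _ → ∈-allFin _ ; outside = λ _ → ∈-allFin _ }

corollary2 : (n : ℕ) (D : Digraph n) (k : ℕ) → n ∸ 1 ≤ k →
    Mixing D k × DiameterAtMost D k (2 * n)
corollary2 n D k n∸1≤k = mixing , diameter
  where
  enough-colours : n ≤ suc (length (allFin k))
  enough-colours = ≤-trans (m≤n+m∸n n 1) (s≤s (subst (n ∸ 1 ≤_) (sym (length-tabulate id)) n∸1≤k))
  diameter : DiameterAtMost D k (2 * n)
  diameter α β = shortWalks n (length-tabulate id) (allFin⁺ n) (allFin⁺ k) enough-colours α β
                   (all-confined (proj₁ α)) (all-confined (proj₁ β)) (λ w∉ → ⊥-elim (w∉ (∈-allFin _)))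
  mixing : Mixing D k
  mixing α β = let ℓ , _ , walk = diameter α β in ℓ , walk
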